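{- $c(C_5,B)\le 1/16$, where $C_5$ is the cycle of length 5 and $B$ is the banner graph.
   Context: The banner graph $B$ is obtained from the 4-cycle $C_4$ by adding a pendant edge. For graphs $H,G$, $t(H,G)$ is the probability that a uniformly random map $V(H)\to V(G)$ is a homomorphism. Let $G_1,G_2,\dots$ be a sequence containing every finite graph exactly once; $\overline{G}$ is the complement. For $\lambda\in[0,2]$, $c_\lambda(H_1,H_2):=\liminf_{n\to\infty}[\lambda\, t(H_1,G_n)+(2-\lambda)\, t(H_2,\overline{G_n})]$ and $c(H_1,H_2):=\sup_{\lambda\in[0,2]}c_\lambda(H_1,H_2)$.
   Formalization: The parameter λ in the supremum defining c(C₅,B) ranges only over the rationals in [0,2]. -}

module Defs where

open import Data.Nat using (ℕ; zero; suc; _^_) renaming (_≤_ to _≤ℕ_)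
open import Data.Nat.Properties using (m^n≢0)
open import Data.Fin using (Fin; zero; suc; _≟_)
open import Data.Bool using (Bool; true; false; not; if_then_else_)
open import Data.List using (List; []; _∷_; map; concatMap; filter; length)

open import Data.Vec using (Vec; []; _∷_; lookup)
open import Data.Product using (_×_; _,_; proj₁; proj₂; Σ; ∃-syntax)
open import Data.Fin.Base using () renaming (zero to f0)
open import Data.List.Base using (allFin)
open import Data.Integer using (+_)
open import Data.Rational using (ℚ; _/_; _+_; _*_; _-_; _≤_; _<_; 0ℚ)
open import Relation.Nullary using (does; yes; no)
open import Relation.Binary.PropositionalEquality using (_≡_; refl; sym)

record Graph (n : ℕ) : Set where
  field
    adj    : Fin n → Fin n → Bool
    adjSym : ∀ i j → adj i j ≡ adj j i
    adjIrr : ∀ i → adj i i ≡ false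
open Graph public

complement : ∀ {n} → Graph n → Graph n
complement {n} G = record { adj = a ; adjSym = s ; adjIrr = r }
  where
  a : Fin n → Fin n → Bool
  a i j = if does (i ≟ j) then false else not (adj G i j)
  s : ∀ i j → a i j ≡ a j i
  s i j with i ≟ j | j ≟ i
  ... | yes _ | yes _ = refl
  ... | yes refl | no ¬p = Data.Empty.⊥-elim (¬p refl)
    where import Data.Empty
  ... | no ¬p | yes refl = Data.Empty.⊥-elim (¬p refl)
    where import Data.Empty
  ... | no _ | no _ rewrite adjSym G i j = refl
  r : ∀ i → a i i ≡ false
  r i with i ≟ i
  ... | yes _ = refl
  ... | no ¬p = Data.Empty.⊥-elim (¬p refl)
    where import Data.Empty

-- A pattern graph H on vertex set Fin k, given by its list of edges
-- (each unordered edge listed once; homomorphism conditions are symmetric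
-- since target graphs are symmetric).
record Pattern : Set where
  field
    size  : ℕ
    edges : List (Fin size × Fin size)
open Pattern public

allB : ∀ {A : Set} → (A → Bool) → List A → Bool
allB p [] = true
allB p (x ∷ xs) = Data.Bool._∧_ (p x) (allB p xs)
  where import Data.Bool

allMaps : (k n : ℕ) → List (Vec (Fin n) k)
allMaps zero    n = [] ∷ []
allMaps (suc k) n = concatMap (λ v → map (λ x → x ∷ v) (allFin n)) (allMaps k n)

isHom : (H : Pattern) → ∀ {n} → Graph n → Vec (Fin n) (size H) → Bool
isHom H G f = allB (λ e → adj G (lookup f (proj₁ e)) (lookup f (proj₂ e))) (edges H)

homCount : (H : Pattern) → ∀ {n} → Graph n → ℕ
homCount H {n} G = length (filter (λ f → isHom H G f Data.Bool.≟ true) (allMaps (size H) n))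
  where import Data.Bool

-- Homomorphism density t(H,G) = hom(H,G) / n^{|V(H)|}
-- (convention: 0 for the empty graph, which never matters below).
t : (H : Pattern) → ∀ {n} → Graph n → ℚ
t H {zero}  G = 0ℚ
t H {suc n} G = (+ homCount H G) / (suc n ^ size H)
  where instance _ = m^n≢0 (suc n) (size H)

v0 v1 v2 v3 v4 : Fin 5
v0 = zero
v1 = suc zero
v2 = suc (suc zero)
v3 = suc (suc (suc zero))
v4 = suc (suc (suc (suc zero)))

C₅ : Pattern
C₅ = record { size = 5 ; edges =
  (v0 , v1) ∷ (v1 , v2) ∷ (v2 , v3) ∷ (v3 , v4) ∷ (v4 , v0) ∷ [] }

-- The banner graph B: the 4-cycle 0-1-2-3-0 plus the pendant edge 0-4.
Banner : Pattern
Banner = record { size = 5 ; edges =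
  (v0 , v1) ∷ (v1 , v2) ∷ (v2 , v3) ∷ (v3 , v0) ∷ (v0 , v4) ∷ [] }

objective : ℚ → Pattern → Pattern → ∀ {n} → Graph n → ℚ
objective λ' H₁ H₂ G = λ' * t H₁ G + (2q - λ') * t H₂ (complement G)
  where 2q = (+ 2) / 1

-- liminf over the enumeration G₁,G₂,… of all finite graphs of F(Gₙ) is ≤ L.
-- Since only finitely many graphs have fewer than m vertices, this is:
-- for every ε > 0 and every m there is a graph G on n ≥ m vertices with F(G) < L + ε.
LiminfLe : (∀ {n} → Graph n → ℚ) → ℚ → Set
LiminfLe F L = ∀ (ε : ℚ) → 0ℚ < ε → ∀ (m : ℕ) →
  ∃[ n ] (m ≤ℕ n × Σ (Graph n) (λ G → F G < L + ε))

cLe : Pattern → Pattern → ℚ → Set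
cLe H₁ H₂ L = ∀ (λ' : ℚ) → 0ℚ ≤ λ' → λ' ≤ (+ 2) / 1 →
  LiminfLe (λ G → objective λ' H₁ H₂ G) L

-- Let A₀ be the symmetric 3 × 3 Boolean matrix below and A₀ ^⊗ k its k-th xor tensor power, a
-- symmetric Boolean matrix on 3ᵏ points; the graph Gₖ keeps its off-diagonal ones. A homomorphism
-- C₅ → Gₖ (resp. B → complement of Gₖ) is in particular a map of the five vertices giving every
-- edge colour 1 (resp. 0) in A₀ ^⊗ k. For a five-edge pattern let N_A(σ) count the maps whose
-- vector of edge colours is σ ∈ 𝔽₂⁵. Edge colours under A ⊗ A′ are the sums of those under A and
-- A′, so N_{A ⊗ A′} is the convolution of N_A and N_{A′} over 𝔽₂⁵. For both C₅ and B every σ is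
-- realised in A₀, so N_{A₀} = 1 + e with ∑ e = 3⁵ − 2⁵ = 211, and therefore
-- max N_{A₀ ^⊗ (k+1)} ≤ 243ᵏ + 211 · max N_{A₀ ^⊗ k}. Both homomorphism counts are thus at most
-- (243ᵏ + 31 · 211ᵏ)/32, both densities are at most 1/32 + o(1), and the objective, a combination
-- of the two densities with total weight 2, is at most 1/16 + o(1).

{-# OPTIONS --safe #-}
module Submission where

open import Defs

open import Algebra.Properties.CommutativeSemigroup using (interchange)
open import Data.Bool as Bool using (Bool; true; false; not; _∧_; _xor_; if_then_else_)
open import Data.Bool.Properties using (not-involutive; not-distribˡ-xor; not-distribʳ-xor; xor-same)
open import Data.Fin using (Fin; zero; suc; _↑ˡ_; _↑ʳ_; combine; quotient; remainder; toℕ; _≟_)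
open import Data.Fin.Properties using (remQuot-combine)
open import Data.List using (List; []; _∷_; _++_; map; concatMap; filter; length; allFin)
open import Data.List.Properties using (map-tabulate)
open import Data.Nat as ℕ using (ℕ; zero; suc; _+_; _*_; _^_; _∸_; _≤_; _<_; z≤n; s≤s; NonZero)
open import Data.Nat.Properties hiding (_≟_)
open import Data.Nat.Solver using () renaming (module +-*-Solver to ℕ-Solver)
open import Data.Product using (_×_; _,_; proj₁; proj₂; ∃-syntax)
open import Data.Unit using (tt)
open import Data.Vec using (Vec; []; _∷_; lookup; zipWith; replicate)
open import Data.Vec.Properties using (lookup-zipWith)
open import Function using (_∘_; id)
open import Relation.Binary.PropositionalEquality
open import Relation.Nullary using (does; yes; no; contradiction)

private
  variable
    A B : Set

-- Finite sums

∑ : List A → (A → ℕ) → ℕ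
∑ []       g = 0
∑ (x ∷ xs) g = g x + ∑ xs g

syntax ∑ xs (λ x → e) = ∑[ x ∈ xs ] e

∑-cong : ∀ (xs : List A) {g h : A → ℕ} → (∀ x → g x ≡ h x) → ∑ xs g ≡ ∑ xs h
∑-cong []       g≗h = refl
∑-cong (x ∷ xs) g≗h = cong₂ _+_ (g≗h x) (∑-cong xs g≗h)

∑-mono-≤ : ∀ (xs : List A) {g h : A → ℕ} → (∀ x → g x ≤ h x) → ∑ xs g ≤ ∑ xs h
∑-mono-≤ []       g≤h = z≤n
∑-mono-≤ (x ∷ xs) g≤h = +-mono-≤ (g≤h x) (∑-mono-≤ xs g≤h)

∑-zero : ∀ (xs : List A) → ∑[ _ ∈ xs ] 0 ≡ 0
∑-zero []       = refl
∑-zero (x ∷ xs) = ∑-zero xs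

∑-++ : ∀ (xs ys : List A) g → ∑ (xs ++ ys) g ≡ ∑ xs g + ∑ ys g
∑-++ []       ys g = refl
∑-++ (x ∷ xs) ys g = trans (cong (g x +_) (∑-++ xs ys g)) (sym (+-assoc (g x) _ _))

∑-+ : ∀ (xs : List A) g h → ∑[ x ∈ xs ] (g x + h x) ≡ ∑ xs g + ∑ xs h
∑-+ []       g h = refl
∑-+ (x ∷ xs) g h = trans (cong (g x + h x +_) (∑-+ xs g h))
                         (interchange +-commutativeSemigroup (g x) (h x) (∑ xs g) (∑ xs h))

∑-*ʳ : ∀ (xs : List A) g c → ∑[ x ∈ xs ] (g x * c) ≡ ∑ xs g * c
∑-*ʳ []       g c = refl
∑-*ʳ (x ∷ xs) g c = trans (cong (g x * c +_) (∑-*ʳ xs g c)) (sym (*-distribʳ-+ c (g x) (∑ xs g)))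

∑-map : ∀ (f : B → A) (xs : List B) g → ∑ (map f xs) g ≡ ∑ xs (g ∘ f)
∑-map f []       g = refl
∑-map f (x ∷ xs) g = cong (g (f x) +_) (∑-map f xs g)

∑-concatMap : ∀ (f : B → List A) (xs : List B) g → ∑ (concatMap f xs) g ≡ ∑[ x ∈ xs ] ∑ (f x) g
∑-concatMap f []       g = refl
∑-concatMap f (x ∷ xs) g = trans (∑-++ (f x) (concatMap f xs) g) (cong (∑ (f x) g +_) (∑-concatMap f xs g))

∑-comm : ∀ (xs : List A) (ys : List B) (g : A → B → ℕ) →
         ∑[ x ∈ xs ] ∑[ y ∈ ys ] g x y ≡ ∑[ y ∈ ys ] ∑[ x ∈ xs ] g x y
∑-comm []       ys g = sym (∑-zero ys)
∑-comm (x ∷ xs) ys g = trans (cong (∑ ys (g x) +_) (∑-comm xs ys g)) (sym (∑-+ ys (g x) _))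

∑-allFin-suc : ∀ n (g : Fin (suc n) → ℕ) → ∑ (allFin (suc n)) g ≡ g zero + ∑[ i ∈ allFin n ] g (suc i)
∑-allFin-suc n g =
  cong (g zero +_) (trans (cong (λ is → ∑ is g) (sym (map-tabulate id suc))) (∑-map suc (allFin n) g))

∑-allFin-+ : ∀ m n (g : Fin (m + n) → ℕ) →
             ∑ (allFin (m + n)) g ≡ ∑[ i ∈ allFin m ] g (i ↑ˡ n) + ∑[ j ∈ allFin n ] g (m ↑ʳ j)
∑-allFin-+ zero    n g = refl
∑-allFin-+ (suc m) n g = begin
  ∑ (allFin (suc m + n)) g
    ≡⟨ ∑-allFin-suc (m + n) g ⟩
  g zero + ∑[ k ∈ allFin (m + n) ] g (suc k)
    ≡⟨ cong (g zero +_) (∑-allFin-+ m n (g ∘ suc)) ⟩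
  g zero + (∑[ i ∈ allFin m ] g (suc (i ↑ˡ n)) + ∑[ j ∈ allFin n ] g (suc m ↑ʳ j))
    ≡⟨ sym (+-assoc (g zero) _ _) ⟩
  g zero + ∑[ i ∈ allFin m ] g (suc (i ↑ˡ n)) + ∑[ j ∈ allFin n ] g (suc m ↑ʳ j)
    ≡⟨ cong (_+ ∑[ j ∈ allFin n ] g (suc m ↑ʳ j)) (sym (∑-allFin-suc m (λ i → g (i ↑ˡ n)))) ⟩
  ∑[ i ∈ allFin (suc m) ] g (i ↑ˡ n) + ∑[ j ∈ allFin n ] g (suc m ↑ʳ j) ∎
  where open ≡-Reasoning

∑-allFin-* : ∀ m n (g : Fin (m * n) → ℕ) →
             ∑ (allFin (m * n)) g ≡ ∑[ i ∈ allFin m ] ∑[ j ∈ allFin n ] g (combine i j)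
∑-allFin-* zero    n g = refl
∑-allFin-* (suc m) n g = begin
  ∑ (allFin (n + m * n)) g
    ≡⟨ ∑-allFin-+ n (m * n) g ⟩
  ∑[ j ∈ allFin n ] g (j ↑ˡ (m * n)) + ∑[ k ∈ allFin (m * n) ] g (n ↑ʳ k)
    ≡⟨ cong (∑[ j ∈ allFin n ] g (j ↑ˡ (m * n)) +_) (∑-allFin-* m n (λ k → g (n ↑ʳ k))) ⟩
  ∑[ j ∈ allFin n ] g (j ↑ˡ (m * n)) + ∑[ i ∈ allFin m ] ∑[ j ∈ allFin n ] g (n ↑ʳ combine i j)
    ≡⟨ sym (∑-allFin-suc m (λ i → ∑[ j ∈ allFin n ] g (combine i j))) ⟩
  ∑[ i ∈ allFin (suc m) ] ∑[ j ∈ allFin n ] g (combine i j) ∎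
  where open ≡-Reasoning

∑-allFin-1 : ∀ n → ∑[ _ ∈ allFin n ] 1 ≡ n
∑-allFin-1 zero    = refl
∑-allFin-1 (suc n) = trans (∑-allFin-suc n (λ _ → 1)) (cong suc (∑-allFin-1 n))

∑-allMaps-suc : ∀ k n (g : Vec (Fin n) (suc k) → ℕ) →
                ∑ (allMaps (suc k) n) g ≡ ∑[ f ∈ allMaps k n ] ∑[ i ∈ allFin n ] g (i ∷ f)
∑-allMaps-suc k n g =
  trans (∑-concatMap _ (allMaps k n) g) (∑-cong (allMaps k n) (λ f → ∑-map (_∷ f) (allFin n) g))

∑-allMaps-* : ∀ k m n (g : Vec (Fin (m * n)) k → ℕ) →
              ∑ (allMaps k (m * n)) g ≡ ∑[ f ∈ allMaps k m ] ∑[ h ∈ allMaps k n ] g (zipWith combine f h)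
∑-allMaps-* zero    m n g = sym (+-identityʳ (g [] + 0))
∑-allMaps-* (suc k) m n g = begin
  ∑ (allMaps (suc k) (m * n)) g
    ≡⟨ ∑-allMaps-suc k (m * n) g ⟩
  ∑[ v ∈ allMaps k (m * n) ] ∑[ x ∈ allFin (m * n) ] g (x ∷ v)
    ≡⟨ ∑-allMaps-* k m n _ ⟩
  ∑[ f ∈ allMaps k m ] ∑[ h ∈ allMaps k n ] ∑[ x ∈ allFin (m * n) ] g (x ∷ f⊗h f h)
    ≡⟨ ∑-cong (allMaps k m) (λ f → ∑-cong (allMaps k n) (λ h → ∑-allFin-* m n _)) ⟩
  ∑[ f ∈ allMaps k m ] ∑[ h ∈ allMaps k n ] ∑[ i ∈ allFin m ] ∑[ j ∈ allFin n ] g (combine i j ∷ f⊗h f h)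
    ≡⟨ ∑-cong (allMaps k m) (λ f → ∑-comm (allMaps k n) (allFin m) _) ⟩
  ∑[ f ∈ allMaps k m ] ∑[ i ∈ allFin m ] ∑[ h ∈ allMaps k n ] ∑[ j ∈ allFin n ] g (combine i j ∷ f⊗h f h)
    ≡⟨ ∑-cong (allMaps k m) (λ f → ∑-cong (allFin m) (λ i → sym (∑-allMaps-suc k n _))) ⟩
  ∑[ f ∈ allMaps k m ] ∑[ i ∈ allFin m ] ∑[ h ∈ allMaps (suc k) n ] g (f⊗h (i ∷ f) h)
    ≡⟨ sym (∑-allMaps-suc k m _) ⟩
  ∑[ f ∈ allMaps (suc k) m ] ∑[ h ∈ allMaps (suc k) n ] g (f⊗h f h) ∎
  where
  open ≡-Reasoning
  f⊗h : ∀ {k} → Vec (Fin m) k → Vec (Fin n) k → Vec (Fin (m * n)) k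
  f⊗h = zipWith combine

∑-allMaps-1 : ∀ k n → ∑[ _ ∈ allMaps k n ] 1 ≡ n ^ k
∑-allMaps-1 zero    n = refl
∑-allMaps-1 (suc k) n = begin
  ∑[ _ ∈ allMaps (suc k) n ] 1               ≡⟨ ∑-allMaps-suc k n _ ⟩
  ∑[ _ ∈ allMaps k n ] ∑[ _ ∈ allFin n ] 1   ≡⟨ ∑-cong (allMaps k n) (λ _ → trans (∑-allFin-1 n) (sym (*-identityˡ n))) ⟩
  ∑[ _ ∈ allMaps k n ] (1 * n)               ≡⟨ ∑-*ʳ (allMaps k n) _ n ⟩
  (∑[ _ ∈ allMaps k n ] 1) * n               ≡⟨ cong (_* n) (∑-allMaps-1 k n) ⟩
  n ^ k * n                                  ≡⟨ *-comm (n ^ k) n ⟩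
  n ^ suc k                                  ∎
  where open ≡-Reasoning

-- Parity vectors and fibre sizes

infixl 6 _⊕_
infix  4 _≐_

_⊕_ : ∀ {L} → Vec Bool L → Vec Bool L → Vec Bool L
_⊕_ = zipWith _xor_

_≐_ : ∀ {L} → Vec Bool L → Vec Bool L → Bool
[]      ≐ []      = true
(a ∷ x) ≐ (b ∷ y) = not (a xor b) ∧ (x ≐ y)

⟦_⟧ : Bool → ℕ
⟦ true  ⟧ = 1
⟦ false ⟧ = 0

⟦⟧≤1 : ∀ b → ⟦ b ⟧ ≤ 1
⟦⟧≤1 true  = s≤s z≤n
⟦⟧≤1 false = z≤n

parities : ∀ L → List (Vec Bool L)
parities zero    = [] ∷ []
parities (suc L) = map (true ∷_) (parities L) ++ map (false ∷_) (parities L)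

∑-parities-suc : ∀ L (g : Vec Bool (suc L) → ℕ) →
                 ∑ (parities (suc L)) g ≡ ∑[ τ ∈ parities L ] g (true ∷ τ) + ∑[ τ ∈ parities L ] g (false ∷ τ)
∑-parities-suc L g = trans (∑-++ (map (true ∷_) (parities L)) _ g)
                           (cong₂ _+_ (∑-map (true ∷_) (parities L) g) (∑-map (false ∷_) (parities L) g))

∑-parities-⊕ : ∀ {L} (σ : Vec Bool L) (g : Vec Bool L → ℕ) → ∑[ τ ∈ parities L ] g (τ ⊕ σ) ≡ ∑ (parities L) g
∑-parities-⊕ []      g = refl
∑-parities-⊕ {suc L} (false ∷ σ) g = begin
  ∑[ τ ∈ parities (suc L) ] g (τ ⊕ (false ∷ σ))
    ≡⟨ ∑-parities-suc L _ ⟩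
  ∑[ τ ∈ parities L ] g (true ∷ τ ⊕ σ) + ∑[ τ ∈ parities L ] g (false ∷ τ ⊕ σ)
    ≡⟨ cong₂ _+_ (∑-parities-⊕ σ (g ∘ (true ∷_))) (∑-parities-⊕ σ (g ∘ (false ∷_))) ⟩
  ∑[ τ ∈ parities L ] g (true ∷ τ) + ∑[ τ ∈ parities L ] g (false ∷ τ)
    ≡⟨ sym (∑-parities-suc L g) ⟩
  ∑ (parities (suc L)) g ∎
  where open ≡-Reasoning
∑-parities-⊕ {suc L} (true ∷ σ) g = begin
  ∑[ τ ∈ parities (suc L) ] g (τ ⊕ (true ∷ σ))
    ≡⟨ ∑-parities-suc L _ ⟩
  ∑[ τ ∈ parities L ] g (false ∷ τ ⊕ σ) + ∑[ τ ∈ parities L ] g (true ∷ τ ⊕ σ)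
    ≡⟨ cong₂ _+_ (∑-parities-⊕ σ (g ∘ (false ∷_))) (∑-parities-⊕ σ (g ∘ (true ∷_))) ⟩
  ∑[ τ ∈ parities L ] g (false ∷ τ) + ∑[ τ ∈ parities L ] g (true ∷ τ)
    ≡⟨ +-comm (∑[ τ ∈ parities L ] g (false ∷ τ)) _ ⟩
  ∑[ τ ∈ parities L ] g (true ∷ τ) + ∑[ τ ∈ parities L ] g (false ∷ τ)
    ≡⟨ sym (∑-parities-suc L g) ⟩
  ∑ (parities (suc L)) g ∎
  where open ≡-Reasoning

∑-parities-≐ : ∀ {L} (x : Vec Bool L) (g : Vec Bool L → ℕ) → ∑[ τ ∈ parities L ] (⟦ x ≐ τ ⟧ * g τ) ≡ g x
∑-parities-≐ []      g = trans (+-identityʳ (g [] + 0)) (+-identityʳ (g []))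
∑-parities-≐ {suc L} (true ∷ x) g = begin
  ∑[ τ ∈ parities (suc L) ] (⟦ true ∷ x ≐ τ ⟧ * g τ)
    ≡⟨ ∑-parities-suc L _ ⟩
  ∑[ τ ∈ parities L ] (⟦ x ≐ τ ⟧ * g (true ∷ τ)) + ∑[ _ ∈ parities L ] 0
    ≡⟨ cong₂ _+_ (∑-parities-≐ x (g ∘ (true ∷_))) (∑-zero (parities L)) ⟩
  g (true ∷ x) + 0
    ≡⟨ +-identityʳ _ ⟩
  g (true ∷ x) ∎
  where open ≡-Reasoning
∑-parities-≐ {suc L} (false ∷ x) g = begin
  ∑[ τ ∈ parities (suc L) ] (⟦ false ∷ x ≐ τ ⟧ * g τ)
    ≡⟨ ∑-parities-suc L _ ⟩
  ∑[ _ ∈ parities L ] 0 + ∑[ τ ∈ parities L ] (⟦ x ≐ τ ⟧ * g (false ∷ τ))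
    ≡⟨ cong₂ _+_ (∑-zero (parities L)) (∑-parities-≐ x (g ∘ (false ∷_))) ⟩
  g (false ∷ x) ∎
  where open ≡-Reasoning

⊕-≐-swap : ∀ {L} (x y z : Vec Bool L) → (x ⊕ y ≐ z) ≡ (y ≐ x ⊕ z)
⊕-≐-swap []      []      []      = refl
⊕-≐-swap (a ∷ x) (b ∷ y) (c ∷ z) = cong₂ (λ u v → not u ∧ v) (xor-swap a b c) (⊕-≐-swap x y z)
  where
  xor-swap : ∀ a b c → (a xor b) xor c ≡ b xor (a xor c)
  xor-swap false b c = refl
  xor-swap true  b c = trans (sym (not-distribˡ-xor b c)) (not-distribʳ-xor b c)

fibreSize : ∀ {L} → List A → (A → Vec Bool L) → Vec Bool L → ℕ
fibreSize xs p σ = ∑[ x ∈ xs ] ⟦ p x ≐ σ ⟧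

module _ {L : ℕ} where

  fibreSize-≤ : ∀ (xs : List A) (p : A → Vec Bool L) σ → fibreSize xs p σ ≤ ∑[ _ ∈ xs ] 1
  fibreSize-≤ xs p σ = ∑-mono-≤ xs (λ x → ⟦⟧≤1 (p x ≐ σ))

  ∑-fibreSize : ∀ (xs : List A) (p : A → Vec Bool L) → ∑ (parities L) (fibreSize xs p) ≡ ∑[ _ ∈ xs ] 1
  ∑-fibreSize xs p = begin
    ∑[ τ ∈ parities L ] ∑[ x ∈ xs ] ⟦ p x ≐ τ ⟧
      ≡⟨ ∑-comm (parities L) xs _ ⟩
    ∑[ x ∈ xs ] ∑[ τ ∈ parities L ] ⟦ p x ≐ τ ⟧
      ≡⟨ ∑-cong xs (λ x → trans (∑-cong (parities L) (λ τ → sym (*-identityʳ _))) (∑-parities-≐ (p x) (λ _ → 1))) ⟩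
    ∑[ _ ∈ xs ] 1 ∎
    where open ≡-Reasoning

  ∑∑-⊕-≐ : ∀ (xs : List A) (ys : List B) (p : A → Vec Bool L) (q : B → Vec Bool L) σ →
           ∑[ x ∈ xs ] ∑[ y ∈ ys ] ⟦ p x ⊕ q y ≐ σ ⟧
           ≡ ∑[ τ ∈ parities L ] (fibreSize xs p τ * fibreSize ys q (τ ⊕ σ))
  ∑∑-⊕-≐ xs ys p q σ = begin
    ∑[ x ∈ xs ] ∑[ y ∈ ys ] ⟦ p x ⊕ q y ≐ σ ⟧
      ≡⟨ ∑-cong xs (λ x → ∑-cong ys (λ y → cong ⟦_⟧ (⊕-≐-swap (p x) (q y) σ))) ⟩
    ∑[ x ∈ xs ] fibreSize ys q (p x ⊕ σ)
      ≡⟨ ∑-cong xs (λ x → sym (∑-parities-≐ (p x) (λ τ → fibreSize ys q (τ ⊕ σ)))) ⟩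
    ∑[ x ∈ xs ] ∑[ τ ∈ parities L ] (⟦ p x ≐ τ ⟧ * fibreSize ys q (τ ⊕ σ))
      ≡⟨ ∑-comm xs (parities L) _ ⟩
    ∑[ τ ∈ parities L ] ∑[ x ∈ xs ] (⟦ p x ≐ τ ⟧ * fibreSize ys q (τ ⊕ σ))
      ≡⟨ ∑-cong (parities L) (λ τ → ∑-*ʳ xs _ _) ⟩
    ∑[ τ ∈ parities L ] (fibreSize xs p τ * fibreSize ys q (τ ⊕ σ)) ∎
    where open ≡-Reasoning

  -- Writing each fibre size of p as 1 plus an excess, the 1s contribute a translate of the sum of
  -- all fibre sizes of q, that is the length of ys.
  ∑∑-⊕-≐-≤ : ∀ (xs : List A) (ys : List B) (p : A → Vec Bool L) (q : B → Vec Bool L) σ {U} →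
             (∀ ρ → fibreSize ys q ρ ≤ U) →
             ∑[ x ∈ xs ] ∑[ y ∈ ys ] ⟦ p x ⊕ q y ≐ σ ⟧
             ≤ (∑[ _ ∈ ys ] 1) + (∑[ τ ∈ parities L ] (fibreSize xs p τ ∸ 1)) * U
  ∑∑-⊕-≐-≤ xs ys p q σ {U} q≤U = begin
    ∑[ x ∈ xs ] ∑[ y ∈ ys ] ⟦ p x ⊕ q y ≐ σ ⟧
      ≡⟨ ∑∑-⊕-≐ xs ys p q σ ⟩
    ∑[ τ ∈ parities L ] (P τ * Q τ)
      ≤⟨ ∑-mono-≤ (parities L) (λ τ → *-monoˡ-≤ (Q τ) (m≤n+m∸n (P τ) 1)) ⟩
    ∑[ τ ∈ parities L ] ((1 + (P τ ∸ 1)) * Q τ)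
      ≡⟨ ∑-+ (parities L) Q _ ⟩
    ∑[ τ ∈ parities L ] Q τ + ∑[ τ ∈ parities L ] ((P τ ∸ 1) * Q τ)
      ≤⟨ +-mono-≤ (≤-reflexive (trans (∑-parities-⊕ σ (fibreSize ys q)) (∑-fibreSize ys q)))
                  (∑-mono-≤ (parities L) (λ τ → *-monoʳ-≤ (P τ ∸ 1) (q≤U (τ ⊕ σ)))) ⟩
    (∑[ _ ∈ ys ] 1) + ∑[ τ ∈ parities L ] ((P τ ∸ 1) * U)
      ≡⟨ cong ((∑[ _ ∈ ys ] 1) +_) (∑-*ʳ (parities L) _ U) ⟩
    (∑[ _ ∈ ys ] 1) + (∑[ τ ∈ parities L ] (P τ ∸ 1)) * U ∎
    where
    open ≤-Reasoning
    P Q : Vec Bool L → ℕ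
    P = fibreSize xs p
    Q τ = fibreSize ys q (τ ⊕ σ)

-- Boolean matrices and their xor tensor powers

BoolMatrix : ℕ → Set
BoolMatrix n = Fin n → Fin n → Bool

IsSymmetric : ∀ {n} → BoolMatrix n → Set
IsSymmetric A = ∀ i j → A i j ≡ A j i

edgeColours : ∀ {n s} → BoolMatrix n → (E : List (Fin s × Fin s)) → Vec (Fin n) s → Vec Bool (length E)
edgeColours A []            f = []
edgeColours A ((i , j) ∷ E) f = A (lookup f i) (lookup f j) ∷ edgeColours A E f

colourCount : ∀ {n s} → BoolMatrix n → (E : List (Fin s × Fin s)) → Vec Bool (length E) → ℕ
colourCount {n} {s} A E = fibreSize (allMaps s n) (edgeColours A E)

colourCount-≤ : ∀ {n s} (A : BoolMatrix n) (E : List (Fin s × Fin s)) σ → colourCount A E σ ≤ n ^ s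
colourCount-≤ {n} {s} A E σ =
  ≤-trans (fibreSize-≤ (allMaps s n) (edgeColours A E) σ) (≤-reflexive (∑-allMaps-1 s n))

infixr 7 _⊗_

_⊗_ : ∀ {m n} → BoolMatrix m → BoolMatrix n → BoolMatrix (m * n)
(_⊗_ {m} {n} A B) x y = A (quotient {m} n x) (quotient {m} n y) xor B (remainder {m} n x) (remainder {m} n y)

⊗-combine : ∀ {m n} (A : BoolMatrix m) (B : BoolMatrix n) i j i′ j′ →
            (A ⊗ B) (combine i j) (combine i′ j′) ≡ A i i′ xor B j j′
⊗-combine {m} {n} A B i j i′ j′ =
  cong₂ (λ x y → A (proj₁ x) (proj₁ y) xor B (proj₂ x) (proj₂ y))
        (remQuot-combine {m} {n} i j) (remQuot-combine {m} {n} i′ j′)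

⊗-sym : ∀ {m n} {A : BoolMatrix m} {B : BoolMatrix n} → IsSymmetric A → IsSymmetric B → IsSymmetric (A ⊗ B)
⊗-sym symA symB x y = cong₂ _xor_ (symA _ _) (symB _ _)

edgeColours-⊗ : ∀ {m n s} (A : BoolMatrix m) (B : BoolMatrix n) (E : List (Fin s × Fin s)) f h →
                edgeColours (A ⊗ B) E (zipWith combine f h) ≡ edgeColours A E f ⊕ edgeColours B E h
edgeColours-⊗ A B []            f h = refl
edgeColours-⊗ A B ((i , j) ∷ E) f h
  rewrite lookup-zipWith combine i f h | lookup-zipWith combine j f h
  = cong₂ _∷_ (⊗-combine A B (lookup f i) (lookup h i) (lookup f j) (lookup h j)) (edgeColours-⊗ A B E f h)

colourCount-⊗-≤ : ∀ {m n s} (A : BoolMatrix m) (B : BoolMatrix n) (E : List (Fin s × Fin s)) {U} →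
                  (∀ ρ → colourCount B E ρ ≤ U) → ∀ σ →
                  colourCount (A ⊗ B) E σ ≤ n ^ s + (∑[ τ ∈ parities (length E) ] (colourCount A E τ ∸ 1)) * U
colourCount-⊗-≤ {m} {n} {s} A B E {U} B≤U σ = begin
  colourCount (A ⊗ B) E σ
    ≡⟨ ∑-allMaps-* s m n _ ⟩
  ∑[ f ∈ allMaps s m ] ∑[ h ∈ allMaps s n ] ⟦ edgeColours (A ⊗ B) E (zipWith combine f h) ≐ σ ⟧
    ≡⟨ ∑-cong (allMaps s m) (λ f → ∑-cong (allMaps s n) (λ h →
         cong (λ c → ⟦ c ≐ σ ⟧) (edgeColours-⊗ A B E f h))) ⟩
  ∑[ f ∈ allMaps s m ] ∑[ h ∈ allMaps s n ] ⟦ edgeColours A E f ⊕ edgeColours B E h ≐ σ ⟧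
    ≤⟨ ∑∑-⊕-≐-≤ (allMaps s m) (allMaps s n) (edgeColours A E) (edgeColours B E) σ B≤U ⟩
  (∑[ _ ∈ allMaps s n ] 1) + (∑[ τ ∈ parities (length E) ] (colourCount A E τ ∸ 1)) * U
    ≡⟨ cong (_+ _) (∑-allMaps-1 s n) ⟩
  n ^ s + (∑[ τ ∈ parities (length E) ] (colourCount A E τ ∸ 1)) * U ∎
  where open ≤-Reasoning

infixr 8 _^⊗_

_^⊗_ : ∀ {n} → BoolMatrix n → (k : ℕ) → BoolMatrix (n ^ k)
(A ^⊗ zero)  _ _ = false
A ^⊗ suc k = A ⊗ A ^⊗ k

^⊗-sym : ∀ {n} {A : BoolMatrix n} → IsSymmetric A → ∀ k → IsSymmetric (A ^⊗ k)
^⊗-sym symA zero    i j = refl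
^⊗-sym symA (suc k)     = ⊗-sym symA (^⊗-sym symA k)

^-^-comm : ∀ n k s → (n ^ k) ^ s ≡ (n ^ s) ^ k
^-^-comm n k s = trans (^-*-assoc n k s) (trans (cong (n ^_) (*-comm k s)) (sym (^-*-assoc n s k)))

powerBound : (a d : ℕ) → ℕ → ℕ
powerBound a d zero    = 1
powerBound a d (suc k) = a ^ k + d * powerBound a d k

colourCount-^⊗-≤ : ∀ {n s} (A : BoolMatrix n) (E : List (Fin s × Fin s)) {d} →
                   ∑[ τ ∈ parities (length E) ] (colourCount A E τ ∸ 1) ≤ d →
                   ∀ k σ → colourCount (A ^⊗ k) E σ ≤ powerBound (n ^ s) d k
colourCount-^⊗-≤ {n} {s} A E excess≤d zero σ =
  ≤-trans (colourCount-≤ (A ^⊗ zero) E σ) (≤-reflexive (^-zeroˡ s))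
colourCount-^⊗-≤ {n} {s} A E {d} excess≤d (suc k) σ = begin
  colourCount (A ⊗ A ^⊗ k) E σ
    ≤⟨ colourCount-⊗-≤ A (A ^⊗ k) E (colourCount-^⊗-≤ A E excess≤d k) σ ⟩
  (n ^ k) ^ s + (∑[ τ ∈ parities (length E) ] (colourCount A E τ ∸ 1)) * powerBound (n ^ s) d k
    ≤⟨ +-mono-≤ (≤-reflexive (^-^-comm n k s)) (*-monoˡ-≤ _ excess≤d) ⟩
  (n ^ s) ^ k + d * powerBound (n ^ s) d k ∎
  where open ≤-Reasoning

loopless : ∀ {n} (A : BoolMatrix n) → IsSymmetric A → Graph n
loopless {n} A symA = record { adj = a ; adjSym = a-sym ; adjIrr = a-irr }
  where
  a : BoolMatrix n
  a i j = if does (i ≟ j) then false else A i j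
  a-sym : IsSymmetric a
  a-sym i j with i ≟ j | j ≟ i
  ... | yes _    | yes _    = refl
  ... | yes refl | no j≢i   = contradiction refl j≢i
  ... | no i≢j   | yes refl = contradiction refl i≢j
  ... | no _     | no _     = symA i j
  a-irr : ∀ i → a i i ≡ false
  a-irr i with i ≟ i
  ... | yes _  = refl
  ... | no i≢i = contradiction refl i≢i

adj-loopless : ∀ {n} (A : BoolMatrix n) symA i j → adj (loopless A symA) i j ≡ true → A i j ≡ true
adj-loopless A symA i j with does (i ≟ j)
... | true  = λ ()
... | false = id

adj-complement-loopless : ∀ {n} (A : BoolMatrix n) symA i j →
                          adj (complement (loopless A symA)) i j ≡ true → A i j ≡ false
adj-complement-loopless A symA i j with does (i ≟ j)
... | true  = λ ()
... | false = λ ¬A≡true → trans (sym (not-involutive (A i j))) (cong not ¬A≡true)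

length-filter-≡true : ∀ (b : A → Bool) xs → length (filter (λ x → b x Bool.≟ true) xs) ≡ ∑[ x ∈ xs ] ⟦ b x ⟧
length-filter-≡true b []       = refl
length-filter-≡true b (x ∷ xs) with b x
... | true  = cong suc (length-filter-≡true b xs)
... | false = length-filter-≡true b xs

homCount-≤-colourCount : ∀ (H : Pattern) {n} (G : Graph n) (A : BoolMatrix n) b →
                         (∀ i j → adj G i j ≡ true → A i j ≡ b) →
                         homCount H G ≤ colourCount A (edges H) (replicate (length (edges H)) b)
homCount-≤-colourCount H {n} G A b G⇒A = begin
  homCount H G                                 ≡⟨ length-filter-≡true (isHom H G) (allMaps (size H) n) ⟩
  ∑[ f ∈ allMaps (size H) n ] ⟦ isHom H G f ⟧  ≤⟨ ∑-mono-≤ (allMaps (size H) n) (edgesPreserved-≤ (edges H)) ⟩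
  colourCount A (edges H) (replicate _ b)      ∎
  where
  open ≤-Reasoning
  edgesPreserved-≤ : ∀ E f → ⟦ allB (λ e → adj G (lookup f (proj₁ e)) (lookup f (proj₂ e))) E ⟧
                             ≤ ⟦ edgeColours A E f ≐ replicate (length E) b ⟧
  edgesPreserved-≤ []            f = ≤-refl
  edgesPreserved-≤ ((i , j) ∷ E) f with adj G (lookup f i) (lookup f j) in fi~fj
  ... | false = z≤n
  ... | true rewrite G⇒A _ _ fi~fj | xor-same b = edgesPreserved-≤ E f

-- The matrix with rows 001, 010, 101: its (i, j) entry depends only on i + j.
A₀ : BoolMatrix 3
A₀ i j = hankel (toℕ i + toℕ j)
  where
  hankel : ℕ → Bool
  hankel 2 = true
  hankel 4 = true
  hankel _ = false

A₀-sym : IsSymmetric A₀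
A₀-sym i j rewrite +-comm (toℕ i) (toℕ j) = refl

-- Each of the 2⁵ edge colourings is realised by some of the 3⁵ maps, so the excess is 3⁵ − 2⁵.
excess-C₅ : ∑[ τ ∈ parities 5 ] (colourCount A₀ (edges C₅) τ ∸ 1) ≤ 211
excess-C₅ = ≤-refl

excess-Banner : ∑[ τ ∈ parities 5 ] (colourCount A₀ (edges Banner) τ ∸ 1) ≤ 211
excess-Banner = ≤-refl

powerGraph : ∀ k → Graph (3 ^ k)
powerGraph k = loopless (A₀ ^⊗ k) (^⊗-sym A₀-sym k)

homBound : ℕ → ℕ
homBound = powerBound 243 211

homCount-C₅-≤ : ∀ k → homCount C₅ (powerGraph k) ≤ homBound k
homCount-C₅-≤ k = ≤-trans
  (homCount-≤-colourCount C₅ (powerGraph k) (A₀ ^⊗ k) true (adj-loopless (A₀ ^⊗ k) (^⊗-sym A₀-sym k)))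
  (colourCount-^⊗-≤ A₀ (edges C₅) excess-C₅ k (replicate 5 true))

homCount-Banner-≤ : ∀ k → homCount Banner (complement (powerGraph k)) ≤ homBound k
homCount-Banner-≤ k = ≤-trans
  (homCount-≤-colourCount Banner (complement (powerGraph k)) (A₀ ^⊗ k) false
                          (adj-complement-loopless (A₀ ^⊗ k) (^⊗-sym A₀-sym k)))
  (colourCount-^⊗-≤ A₀ (edges Banner) excess-Banner k (replicate 5 false))

homBound-closedForm : ∀ k → 32 * homBound k ≡ 243 ^ k + 31 * 211 ^ k
homBound-closedForm zero    = refl
homBound-closedForm (suc k) = begin
  32 * (243 ^ k + 211 * homBound k)             ≡⟨ distrib (243 ^ k) (homBound k) ⟩
  32 * 243 ^ k + 211 * (32 * homBound k)        ≡⟨ cong (λ u → 32 * 243 ^ k + 211 * u) (homBound-closedForm k) ⟩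
  32 * 243 ^ k + 211 * (243 ^ k + 31 * 211 ^ k) ≡⟨ collect (243 ^ k) (211 ^ k) ⟩
  243 * 243 ^ k + 31 * (211 * 211 ^ k)          ∎
  where
  open ≡-Reasoning
  open ℕ-Solver
  distrib : ∀ a u → 32 * (a + 211 * u) ≡ 32 * a + 211 * (32 * u)
  distrib = solve 2 (λ a u → con 32 :* (a :+ con 211 :* u) := con 32 :* a :+ con 211 :* (con 32 :* u)) refl
  collect : ∀ a b → 32 * a + 211 * (a + 31 * b) ≡ 243 * a + 31 * (211 * b)
  collect = solve 2 (λ a b → con 32 :* a :+ con 211 :* (a :+ con 31 :* b)
                           := con 243 :* a :+ con 31 :* (con 211 :* b)) refl

n<2^n : ∀ n → n < 2 ^ n
n<2^n zero    = s≤s z≤n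
n<2^n (suc n) = begin-strict
  suc n          <⟨ s≤s (n<2^n n) ⟩
  1 + 2 ^ n      ≤⟨ +-monoˡ-≤ (2 ^ n) (m^n>0 2 n) ⟩
  2 ^ n + 2 ^ n  ≡⟨ cong (2 ^ n +_) (sym (+-identityʳ (2 ^ n))) ⟩
  2 ^ suc n      ∎
  where open ≤-Reasoning

^-distribʳ-* : ∀ m n k → (m * n) ^ k ≡ m ^ k * n ^ k
^-distribʳ-* m n zero    = refl
^-distribʳ-* m n (suc k) =
  trans (cong (m * n *_) (^-distribʳ-* m n k)) (interchange *-commutativeSemigroup m n (m ^ k) (n ^ k))

2^j*211^5j≤243^5j : ∀ j → 2 ^ j * 211 ^ (5 * j) ≤ 243 ^ (5 * j)
2^j*211^5j≤243^5j j = begin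
  2 ^ j * 211 ^ (5 * j)  ≡⟨ cong (2 ^ j *_) (sym (^-*-assoc 211 5 j)) ⟩
  2 ^ j * (211 ^ 5) ^ j  ≡⟨ sym (^-distribʳ-* 2 (211 ^ 5) j) ⟩
  (2 * 211 ^ 5) ^ j      ≤⟨ ^-monoˡ-≤ j (≤ᵇ⇒≤ (2 * 211 ^ 5) (243 ^ 5) tt) ⟩
  (243 ^ 5) ^ j          ≡⟨ ^-*-assoc 243 5 j ⟩
  243 ^ (5 * j)          ∎
  where open ≤-Reasoning

-- By the closed form, 2 · homBound k / 243ᵏ = 1/16 + (31/16) (211/243)ᵏ, and (211/243)⁵ < 1/2.
homBound-density : ∀ Q j → 31 * Q ≤ j → 2 * homBound (5 * j) * (16 * Q) < (Q + 16) * (3 ^ (5 * j)) ^ 5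
homBound-density Q j 31Q≤j = begin-strict
  2 * homBound k * (16 * Q)       ≡⟨ regroup (homBound k) Q ⟩
  32 * homBound k * Q             ≡⟨ cong (_* Q) (homBound-closedForm k) ⟩
  (243 ^ k + 31 * 211 ^ k) * Q    ≡⟨ expand (243 ^ k) (211 ^ k) Q ⟩
  Q * 243 ^ k + 31 * Q * 211 ^ k  <⟨ +-monoʳ-< (Q * 243 ^ k) error<16*243^k ⟩
  Q * 243 ^ k + 16 * 243 ^ k      ≡⟨ sym (*-distribʳ-+ (243 ^ k) Q 16) ⟩
  (Q + 16) * 243 ^ k              ≡⟨ cong ((Q + 16) *_) (^-^-comm 3 5 k) ⟩
  (Q + 16) * (3 ^ k) ^ 5          ∎
  where
  open ≤-Reasoning
  open ℕ-Solver
  k = 5 * j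
  regroup : ∀ u q → 2 * u * (16 * q) ≡ 32 * u * q
  regroup = solve 2 (λ u q → con 2 :* u :* (con 16 :* q) := con 32 :* u :* q) refl
  expand : ∀ a b q → (a + 31 * b) * q ≡ q * a + 31 * q * b
  expand = solve 3 (λ a b q → (a :+ con 31 :* b) :* q := q :* a :+ con 31 :* q :* b) refl
  error<16*243^k : 31 * Q * 211 ^ k < 16 * 243 ^ k
  error<16*243^k = begin-strict
    31 * Q * 211 ^ k  <⟨ *-monoˡ-< (211 ^ k) {{m^n≢0 211 k}} (≤-<-trans 31Q≤j (n<2^n j)) ⟩
    2 ^ j * 211 ^ k   ≤⟨ 2^j*211^5j≤243^5j j ⟩
    243 ^ k           ≤⟨ m≤n*m (243 ^ k) 16 ⟩
    16 * 243 ^ k      ∎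

-- Rational estimates

-- Imported only here: in scope, the prefix +_ would make the sections (x +_) above ambiguous.
open import Data.Integer as ℤ using (+_; +≤+; +<+)
import Data.Integer.Properties as ℤ
open import Data.Rational as ℚ using (ℚ; mkℚ; 0ℚ; _/_; toℚᵘ; *<*)
import Data.Rational.Properties as ℚ
open import Data.Rational.Solver using () renaming (module +-*-Solver to ℚ-Solver)
open import Data.Rational.Unnormalised as ℚᵘ using (mkℚᵘ)
import Data.Rational.Unnormalised.Properties as ℚᵘ

mkℚᵘ-≤ : ∀ {a b c d} → a * suc d ≤ c * suc b → mkℚᵘ (+ a) b ℚᵘ.≤ mkℚᵘ (+ c) d
mkℚᵘ-≤ {a} {b} {c} {d} ad≤cb = ℚᵘ.*≤* (subst₂ ℤ._≤_ (ℤ.pos-* a (suc d)) (ℤ.pos-* c (suc b)) (+≤+ ad≤cb))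

mkℚᵘ-< : ∀ {a b c d} → a * suc d < c * suc b → mkℚᵘ (+ a) b ℚᵘ.< mkℚᵘ (+ c) d
mkℚᵘ-< {a} {b} {c} {d} ad<cb = ℚᵘ.*<* (subst₂ ℤ._<_ (ℤ.pos-* a (suc d)) (ℤ.pos-* c (suc b)) (+<+ ad<cb))

mkℚᵘ-+ : ∀ a b c d →
         mkℚᵘ (+ a) b ℚᵘ.+ mkℚᵘ (+ c) d ≡ mkℚᵘ (+ (a * suc d + c * suc b)) (ℕ.pred (suc b * suc d))
mkℚᵘ-+ a b c d = cong (λ n → mkℚᵘ n _) (begin
  + a ℤ.* + suc d ℤ.+ + c ℤ.* + suc b  ≡⟨ cong₂ ℤ._+_ (sym (ℤ.pos-* a (suc d))) (sym (ℤ.pos-* c (suc b))) ⟩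
  + (a * suc d) ℤ.+ + (c * suc b)      ≡⟨ sym (ℤ.pos-+ (a * suc d) (c * suc b)) ⟩
  + (a * suc d + c * suc b)            ∎)
  where open ≡-Reasoning

mkℚᵘ-* : ∀ a b c d → mkℚᵘ (+ a) b ℚᵘ.* mkℚᵘ (+ c) d ≡ mkℚᵘ (+ (a * c)) (ℕ.pred (suc b * suc d))
mkℚᵘ-* a b c d = cong (λ n → mkℚᵘ n _) (sym (ℤ.pos-* a c))

toℚᵘ-/ : ∀ a b → toℚᵘ ((+ a) / suc b) ℚᵘ.≃ mkℚᵘ (+ a) b
toℚᵘ-/ a b = ℚ.toℚᵘ-fromℚᵘ (mkℚᵘ (+ a) b)

/-monoˡ-≤ : ∀ {a c} d .{{_ : NonZero d}} → a ≤ c → (+ a) / d ℚ.≤ (+ c) / d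
/-monoˡ-≤ {a} {c} (suc b) a≤c = ℚ.toℚᵘ-cancel-≤
  (ℚᵘ.≤-respˡ-≃ (ℚᵘ.≃-sym (toℚᵘ-/ a b)) (ℚᵘ.≤-respʳ-≃ (ℚᵘ.≃-sym (toℚᵘ-/ c b)) (mkℚᵘ-≤ (*-monoˡ-≤ (suc b) a≤c))))

pos⇒∃1/suc≤ : ∀ ε → 0ℚ ℚ.< ε → ∃[ q ] (+ 1) / suc q ℚ.≤ ε
pos⇒∃1/suc≤ (mkℚ (+ suc a) d _) _ =
  d , ℚ.toℚᵘ-cancel-≤ (ℚᵘ.≤-respˡ-≃ (ℚᵘ.≃-sym (toℚᵘ-/ 1 d)) (mkℚᵘ-≤ (*-monoˡ-≤ (suc d) {1} {suc a} (s≤s z≤n))))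
pos⇒∃1/suc≤ (mkℚ (+ zero) d _)     (*<* (+<+ ()))
pos⇒∃1/suc≤ (mkℚ ℤ.-[1+ _ ] d _) (*<* ())

2*[V/D]<1/16+1/suc : ∀ V D q .{{_ : NonZero D}} → 2 * V * (16 * suc q) < (suc q + 16) * D →
                     (+ 2) / 1 ℚ.* ((+ V) / D) ℚ.< (+ 1) / 16 ℚ.+ (+ 1) / suc q
2*[V/D]<1/16+1/suc V (suc b) q 2VQ<QD =
  ℚ.toℚᵘ-cancel-< (ℚᵘ.<-respˡ-≃ (ℚᵘ.≃-sym lhs) (ℚᵘ.<-respʳ-≃ (ℚᵘ.≃-sym rhs) (mkℚᵘ-< 2VQ<QD′)))
  where
  lhs : toℚᵘ ((+ 2) / 1 ℚ.* ((+ V) / suc b)) ℚᵘ.≃ mkℚᵘ (+ (2 * V)) (ℕ.pred (1 * suc b))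
  lhs = ℚᵘ.≃-trans (ℚ.toℚᵘ-homo-* ((+ 2) / 1) ((+ V) / suc b))
          (ℚᵘ.≃-trans (ℚᵘ.*-congˡ {mkℚᵘ (+ 2) 0} (toℚᵘ-/ V b)) (ℚᵘ.≃-reflexive (mkℚᵘ-* 2 0 V b)))
  rhs : toℚᵘ ((+ 1) / 16 ℚ.+ (+ 1) / suc q) ℚᵘ.≃ mkℚᵘ (+ (1 * suc q + 1 * 16)) (ℕ.pred (16 * suc q))
  rhs = ℚᵘ.≃-trans (ℚ.toℚᵘ-homo-+ ((+ 1) / 16) ((+ 1) / suc q))
          (ℚᵘ.≃-trans (ℚᵘ.+-congʳ (mkℚᵘ (+ 1) 15) (toℚᵘ-/ 1 q)) (ℚᵘ.≃-reflexive (mkℚᵘ-+ 1 15 1 q)))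
  2VQ<QD′ : 2 * V * (16 * suc q) < (1 * suc q + 1 * 16) * (1 * suc b)
  2VQ<QD′ = subst (2 * V * (16 * suc q) <_)
                  (cong₂ (λ x y → (x + 16) * y) (sym (*-identityˡ (suc q))) (sym (*-identityˡ (suc b))))
                  2VQ<QD

convex-≤ : ∀ {λ′ x y v} → 0ℚ ℚ.≤ λ′ → λ′ ℚ.≤ (+ 2) / 1 → x ℚ.≤ v → y ℚ.≤ v →
           λ′ ℚ.* x ℚ.+ ((+ 2) / 1 ℚ.- λ′) ℚ.* y ℚ.≤ (+ 2) / 1 ℚ.* v
convex-≤ {λ′} {x} {y} {v} 0≤λ λ≤2 x≤v y≤v = begin
  λ′ ℚ.* x ℚ.+ (2ℚ ℚ.- λ′) ℚ.* y  ≤⟨ ℚ.+-mono-≤ (ℚ.*-monoˡ-≤-nonNeg λ′ {{ℚ.nonNegative 0≤λ}} x≤v)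
                                              (ℚ.*-monoˡ-≤-nonNeg (2ℚ ℚ.- λ′) {{ℚ.nonNegative 0≤2-λ}} y≤v) ⟩
  λ′ ℚ.* v ℚ.+ (2ℚ ℚ.- λ′) ℚ.* v  ≡⟨ solve 2 (λ l w → l :* w :+ (con 2ℚ :- l) :* w := con 2ℚ :* w) refl λ′ v ⟩
  2ℚ ℚ.* v                        ∎
  where
  open ℚ.≤-Reasoning
  open ℚ-Solver
  2ℚ : ℚ
  2ℚ = (+ 2) / 1
  0≤2-λ : 0ℚ ℚ.≤ 2ℚ ℚ.- λ′
  0≤2-λ = subst (ℚ._≤ 2ℚ ℚ.- λ′) (ℚ.+-inverseʳ λ′) (ℚ.+-monoˡ-≤ (ℚ.- λ′) λ≤2)

homCount≤⇒t≤ : ∀ (H : Pattern) {n} .{{_ : NonZero n}} (G : Graph n) {V} → homCount H G ≤ V →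
               t H G ℚ.≤ _/_ (+ V) (n ^ size H) {{m^n≢0 n (size H)}}
homCount≤⇒t≤ H {suc n} G hom≤V = /-monoˡ-≤ (suc n ^ size H) {{m^n≢0 (suc n) (size H)}} hom≤V

proposition4p4 : cLe C₅ Banner ((+ 1) / 16)
proposition4p4 λ′ 0≤λ λ≤2 ε 0<ε m with q , 1/q≤ε ← pos⇒∃1/suc≤ ε 0<ε =
  3 ^ k , m≤3^k , powerGraph k , (begin-strict
    objective λ′ C₅ Banner (powerGraph k)
      ≤⟨ convex-≤ 0≤λ λ≤2 (homCount≤⇒t≤ C₅ _ (homCount-C₅-≤ k)) (homCount≤⇒t≤ Banner _ (homCount-Banner-≤ k)) ⟩
    (+ 2) / 1 ℚ.* ((+ homBound k) / (3 ^ k) ^ 5)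
      <⟨ 2*[V/D]<1/16+1/suc (homBound k) ((3 ^ k) ^ 5) q (homBound-density (suc q) j (m≤m+n (31 * suc q) m)) ⟩
    (+ 1) / 16 ℚ.+ (+ 1) / suc q
      ≤⟨ ℚ.+-monoʳ-≤ ((+ 1) / 16) 1/q≤ε ⟩
    (+ 1) / 16 ℚ.+ ε ∎)
  where
  open ℚ.≤-Reasoning
  -- j ≥ 31 (q + 1) brings the bound within 1/(q + 1) of 1/16, and j ≥ m makes the graph large.
  j = 31 * suc q + m
  k = 5 * j
  instance
    3^k≢0 : NonZero (3 ^ k)
    3^k≢0 = m^n≢0 3 k
    [3^k]^5≢0 : NonZero ((3 ^ k) ^ 5)
    [3^k]^5≢0 = m^n≢0 (3 ^ k) 5
  m≤3^k : m ≤ 3 ^ k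
  m≤3^k = ≤-trans (≤-trans (m≤n+m m (31 * suc q)) (m≤n*m j 5))
                  (≤-trans (<⇒≤ (n<2^n k)) (^-monoˡ-≤ k (s≤s (s≤s z≤n))))
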